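{- The logic $\mathbf{PM2}$ does not have unitary type of unification: there is a formula unifiable in $\mathbf{PM2}$ (for instance $\Box x\vee\Box\neg x$) that has no most general unifier.
   Context: $\mathbf{PM2}$ is the normal modal logic (extension of $\mathcal{S}4$) of all finite Kripke frames $\langle\{0,1,\dots,m\},R\rangle$, $m\ge1$, with $xRy\iff(x=0\ \text{or}\ x=y)$. A unifier of $\varphi(p_1,\dots,p_s)$ in $\mathcal{L}$ is a substitution $\sigma$ with $\sigma(\varphi)\in\mathcal{L}$. A unifier $\sigma$ is more general than a unifier $\sigma^1$ ($\sigma^1\preceq\sigma$) if there is a substitution $\sigma^2$ with $\sigma^1(p_i)\leftrightarrow\sigma^2(\sigma(p_i))\in\mathcal{L}$ for all variables $p_i$ of $\varphi$. A most general unifier (mgu) of $\varphi$ is a unifier $\sigma$ with $\sigma^1\preceq\sigma$ for every unifier $\sigma^1$ of $\varphi$. $\mathcal{L}$ has unitary type of unification if every unifiable formula has an mgu. -}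

module Defs where

open import Data.Nat using (ℕ; zero; suc; _+_)
open import Data.Fin using (Fin; zero; suc; _≟_)
open import Data.Bool using (Bool; true; false; _∧_; _∨_; not)
open import Data.Product using (Σ; _×_)
open import Relation.Binary.PropositionalEquality using (_≡_)
open import Relation.Nullary using (¬_)
open import Relation.Nullary.Decidable using (⌊_⌋)

data Fm : Set where
  var  : ℕ → Fm
  ⊥ᶠ   : Fm
  _⇒ᶠ_ : Fm → Fm → Fm
  _∧ᶠ_ : Fm → Fm → Fm
  _∨ᶠ_ : Fm → Fm → Fm
  □_   : Fm → Fm

infixr 5 _⇒ᶠ_
infixr 6 _∨ᶠ_
infixr 7 _∧ᶠ_
infix 8 □_

¬ᶠ_ : Fm → Fm
¬ᶠ φ = φ ⇒ᶠ ⊥ᶠ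

_⇔ᶠ_ : Fm → Fm → Fm
φ ⇔ᶠ ψ = (φ ⇒ᶠ ψ) ∧ᶠ (ψ ⇒ᶠ φ)

-- Frames ⟨{0,…,m},R⟩ with x R y ⇔ (x = 0 or x = y); points are Fin (suc m).
R : ∀ {n} → Fin n → Fin n → Bool
R zero    y = true
R (suc x) y = ⌊ suc x ≟ y ⌋

allF : ∀ n → (Fin n → Bool) → Bool
allF zero    f = true
allF (suc n) f = f zero ∧ allF n (λ y → f (suc y))

eval : ∀ {n} → (ℕ → Fin n → Bool) → Fm → Fin n → Bool
eval V (var p)  x = V p x
eval V ⊥ᶠ       x = false
eval V (φ ⇒ᶠ ψ) x = not (eval V φ x) ∨ eval V ψ x
eval V (φ ∧ᶠ ψ) x = eval V φ x ∧ eval V ψ x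
eval V (φ ∨ᶠ ψ) x = eval V φ x ∨ eval V ψ x
eval {n} V (□ φ) x = allF n (λ y → not (R x y) ∨ eval V φ y)

-- PM2: formulas valid in every frame with m ≥ 1 (i.e. m = suc k, m+1 = 2+k points).
PM2 : Fm → Set
PM2 φ = ∀ (k : ℕ) (V : ℕ → Fin (2 + k) → Bool) (x : Fin (2 + k)) → eval V φ x ≡ true

Subst : Set
Subst = ℕ → Fm

sub : Subst → Fm → Fm
sub σ (var p)  = σ p
sub σ ⊥ᶠ       = ⊥ᶠ
sub σ (φ ⇒ᶠ ψ) = sub σ φ ⇒ᶠ sub σ ψ
sub σ (φ ∧ᶠ ψ) = sub σ φ ∧ᶠ sub σ ψ
sub σ (φ ∨ᶠ ψ) = sub σ φ ∨ᶠ sub σ ψ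
sub σ (□ φ)    = □ sub σ φ

data Occurs (i : ℕ) : Fm → Set where
  here : Occurs i (var i)
  ⇒l : ∀ {φ ψ} → Occurs i φ → Occurs i (φ ⇒ᶠ ψ)
  ⇒r : ∀ {φ ψ} → Occurs i ψ → Occurs i (φ ⇒ᶠ ψ)
  ∧l : ∀ {φ ψ} → Occurs i φ → Occurs i (φ ∧ᶠ ψ)
  ∧r : ∀ {φ ψ} → Occurs i ψ → Occurs i (φ ∧ᶠ ψ)
  ∨l : ∀ {φ ψ} → Occurs i φ → Occurs i (φ ∨ᶠ ψ)
  ∨r : ∀ {φ ψ} → Occurs i ψ → Occurs i (φ ∨ᶠ ψ)
  □i : ∀ {φ} → Occurs i φ → Occurs i (□ φ)

module _ (L : Fm → Set) where

  Unifier : Fm → Subst → Set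
  Unifier φ σ = L (sub σ φ)

  Unifiable : Fm → Set
  Unifiable φ = Σ Subst (Unifier φ)

  -- σ₁ ≼ σ (σ more general than σ₁) w.r.t. the variables of φ
  MoreGeneral : Fm → Subst → Subst → Set
  MoreGeneral φ σ₁ σ =
    Σ Subst λ σ₂ → ∀ i → Occurs i φ → L (σ₁ i ⇔ᶠ sub σ₂ (σ i))

  IsMGU : Fm → Subst → Set
  IsMGU φ σ = Unifier φ σ × (∀ σ₁ → Unifier φ σ₁ → MoreGeneral φ σ₁ σ)

  HasMGU : Fm → Set
  HasMGU φ = Σ Subst (IsMGU φ)

  UnitaryType : Set
  UnitaryType = ∀ φ → Unifiable φ → HasMGU φ

φ₀ : Fm
φ₀ = □ var 0 ∨ᶠ □ (¬ᶠ var 0)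

-- If σ were a most general unifier of □x ∨ □¬x, both constant unifiers x ↦ ⊤ and
-- x ↦ ⊥ would be instances of it, so on the three-point frame A = σ(x) can be made
-- true at the leaf 1 by one valuation and false at the leaf 1 by another. Truth at a
-- leaf depends only on the valuation at that leaf, so both valuations can be glued
-- into one valuation making A true at leaf 1 and false at leaf 2. The root sees both
-- leaves, hence refutes □A ∨ □¬A = σ(□x ∨ □¬x), contradicting that σ is a unifier.
module Submission where

open import Defs
open import Data.Bool using (Bool; true; false; _∧_; _∨_; not)
open import Data.Bool.Properties using (∧-identityʳ; ∨-zeroʳ)
open import Data.Fin using (Fin; zero; suc; _≟_)
open import Data.Nat using (ℕ; zero; suc; _+_)
open import Data.Product using (∃; _×_; _,_)
open import Relation.Binary.PropositionalEquality
open import Relation.Nullary using (¬_; yes; no)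
open import Relation.Nullary.Decidable using (⌊_⌋)

allF-cong : ∀ n {f g : Fin n → Bool} → (∀ y → f y ≡ g y) → allF n f ≡ allF n g
allF-cong zero    f≡g = refl
allF-cong (suc n) f≡g = cong₂ _∧_ (f≡g zero) (allF-cong n (λ y → f≡g (suc y)))

allF-true : ∀ n {f : Fin n → Bool} → (∀ y → f y ≡ true) → allF n f ≡ true
allF-true zero    f≡true = refl
allF-true (suc n) f≡true rewrite f≡true zero = allF-true n (λ y → f≡true (suc y))

allF-single : ∀ n (x : Fin n) (g : Fin n → Bool) →
              allF n (λ y → not ⌊ x ≟ y ⌋ ∨ g y) ≡ g x
allF-single (suc n) zero    g =
  trans (cong (g zero ∧_) (allF-true n (λ y → refl))) (∧-identityʳ (g zero))
allF-single (suc n) (suc x) g =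
  trans (allF-cong n ≟-suc) (allF-single n x (λ y → g (suc y)))
  where
  ≟-suc : ∀ y → (not ⌊ suc x ≟ suc y ⌋ ∨ g (suc y)) ≡ (not ⌊ x ≟ y ⌋ ∨ g (suc y))
  ≟-suc y with x ≟ y
  ... | yes _ = refl
  ... | no  _ = refl

⇔-true⇒≡ : ∀ a b → (not a ∨ b) ∧ (not b ∨ a) ≡ true → a ≡ b
⇔-true⇒≡ true  true  _ = refl
⇔-true⇒≡ false false _ = refl

⊤ᶠ : Fm
⊤ᶠ = ¬ᶠ ⊥ᶠ

eval-□⊤ : ∀ {n} (V : ℕ → Fin n → Bool) x → eval V (□ ⊤ᶠ) x ≡ true
eval-□⊤ {n} V x = allF-true n (λ y → ∨-zeroʳ (not (R x y)))

eval-sub : ∀ {n} (V : ℕ → Fin n → Bool) (τ : Subst) φ x →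
           eval V (sub τ φ) x ≡ eval (λ p → eval V (τ p)) φ x
eval-sub V τ (var p)  x = refl
eval-sub V τ ⊥ᶠ       x = refl
eval-sub V τ (φ ⇒ᶠ ψ) x = cong₂ (λ a b → not a ∨ b) (eval-sub V τ φ x) (eval-sub V τ ψ x)
eval-sub V τ (φ ∧ᶠ ψ) x = cong₂ _∧_ (eval-sub V τ φ x) (eval-sub V τ ψ x)
eval-sub V τ (φ ∨ᶠ ψ) x = cong₂ _∨_ (eval-sub V τ φ x) (eval-sub V τ ψ x)
eval-sub {n} V τ (□ φ) x = allF-cong n (λ y → cong (not (R x y) ∨_) (eval-sub V τ φ y))

-- A non-root point sees only itself, so □ is the identity there.
eval-leaf-cong : ∀ {n n′} (V : ℕ → Fin (suc n) → Bool) (W : ℕ → Fin (suc n′) → Bool)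
                 (x : Fin n) (x′ : Fin n′) → (∀ p → V p (suc x) ≡ W p (suc x′)) →
                 ∀ φ → eval V φ (suc x) ≡ eval W φ (suc x′)
eval-leaf-cong V W x x′ V≡W (var p)  = V≡W p
eval-leaf-cong V W x x′ V≡W ⊥ᶠ       = refl
eval-leaf-cong V W x x′ V≡W (φ ⇒ᶠ ψ) =
  cong₂ (λ a b → not a ∨ b) (eval-leaf-cong V W x x′ V≡W φ) (eval-leaf-cong V W x x′ V≡W ψ)
eval-leaf-cong V W x x′ V≡W (φ ∧ᶠ ψ) =
  cong₂ _∧_ (eval-leaf-cong V W x x′ V≡W φ) (eval-leaf-cong V W x x′ V≡W ψ)
eval-leaf-cong V W x x′ V≡W (φ ∨ᶠ ψ) =
  cong₂ _∨_ (eval-leaf-cong V W x x′ V≡W φ) (eval-leaf-cong V W x x′ V≡W ψ)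
eval-leaf-cong {n} {n′} V W x x′ V≡W (□ φ) = begin
  eval V (□ φ) (suc x)   ≡⟨ allF-single (suc n) (suc x) (eval V φ) ⟩
  eval V φ (suc x)       ≡⟨ eval-leaf-cong V W x x′ V≡W φ ⟩
  eval W φ (suc x′)      ≡⟨ allF-single (suc n′) (suc x′) (eval W φ) ⟨
  eval W (□ φ) (suc x′)  ∎
  where open ≡-Reasoning

moreGeneral-realises : ∀ {φ} σ₁ σ {i} → MoreGeneral PM2 φ σ₁ σ → Occurs i φ →
                       ∀ k (V : ℕ → Fin (2 + k) → Bool) x →
                       ∃ λ (W : ℕ → Fin (2 + k) → Bool) → eval W (σ i) x ≡ eval V (σ₁ i) x
moreGeneral-realises σ₁ σ {i} (σ₂ , σ₁⇔σ₂σ) i∈φ k V x =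
  (λ p → eval V (σ₂ p)) ,
  (begin
    eval (λ p → eval V (σ₂ p)) (σ i) x  ≡⟨ eval-sub V σ₂ (σ i) x ⟨
    eval V (sub σ₂ (σ i)) x             ≡⟨ ⇔-true⇒≡ _ _ (σ₁⇔σ₂σ i i∈φ k V x) ⟨
    eval V (σ₁ i) x                     ∎)
  where open ≡-Reasoning

Valuation₃ : Set
Valuation₃ = ℕ → Fin 3 → Bool

glue : Valuation₃ → Valuation₃ → Valuation₃
glue V₁ V₂ p zero          = false
glue V₁ V₂ p (suc zero)    = V₁ p (suc zero)
glue V₁ V₂ p (suc (suc y)) = V₂ p (suc zero)

root-refutes-□∨□¬ : ∀ (W : Valuation₃) A →
                    eval W A (suc zero) ≡ true → eval W A (suc (suc zero)) ≡ false →
                    eval W (□ A ∨ᶠ □ ¬ᶠ A) zero ≡ false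
root-refutes-□∨□¬ W A A₁ A₂ rewrite A₁ | A₂ with eval W A zero
... | true  = refl
... | false = refl

const⊤-unifies : Unifier PM2 φ₀ (λ _ → ⊤ᶠ)
const⊤-unifies k V x = cong (_∨ eval V (□ ¬ᶠ ⊤ᶠ) x) (eval-□⊤ V x)

const⊥-unifies : Unifier PM2 φ₀ (λ _ → ⊥ᶠ)
const⊥-unifies k V x = trans (cong (eval V (□ ⊥ᶠ) x ∨_) (eval-□⊤ V x)) (∨-zeroʳ _)

φ₀-unifiable : Unifiable PM2 φ₀
φ₀-unifiable = (λ _ → ⊤ᶠ) , const⊤-unifies

0∈φ₀ : Occurs 0 φ₀
0∈φ₀ = ∨l (□i here)

φ₀-noMGU : ¬ HasMGU PM2 φ₀
φ₀-noMGU (σ , σ-unifies , σ-general)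
  with moreGeneral-realises (λ _ → ⊤ᶠ) σ (σ-general (λ _ → ⊤ᶠ) const⊤-unifies)
                            0∈φ₀ 1 (λ _ _ → false) (suc zero)
     | moreGeneral-realises (λ _ → ⊥ᶠ) σ (σ-general (λ _ → ⊥ᶠ) const⊥-unifies)
                            0∈φ₀ 1 (λ _ _ → false) (suc zero)
... | V₁ , A₁ | V₂ , A₂ with trans (sym (σ-unifies 1 W zero)) refutation
  where
  W : Valuation₃
  W = glue V₁ V₂
  refutation : eval W (sub σ φ₀) zero ≡ false
  refutation = root-refutes-□∨□¬ W (σ 0)
    (trans (eval-leaf-cong W V₁ zero zero (λ p → refl) (σ 0)) A₁)
    (trans (eval-leaf-cong W V₂ (suc zero) zero (λ p → refl) (σ 0)) A₂)
... | ()

lemma4 : ¬ UnitaryType PM2 × (Unifiable PM2 φ₀ × ¬ HasMGU PM2 φ₀)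
lemma4 = (λ unitary → φ₀-noMGU (unitary φ₀ φ₀-unifiable)) , φ₀-unifiable , φ₀-noMGU
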